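{- Consider any instance of online submodular order welfare maximization (OSOW) with configurations, as defined in the context. Let $\mathrm{ALG}$ denote the set of configurations chosen by the Greedy algorithm and let $\mathrm{OPT}=\max\{\sum_{i\in I} f_i(S)\,:\, S\subseteq N,\ |S\cap N_t|\le 1\ \forall t\in T\}$ be the optimal offline value. Then $\sum_{i\in I} f_i(\mathrm{ALG})\ \ge\ \tfrac12\,\mathrm{OPT}$, i.e., Greedy is $0.5$-competitive for OSOW with configurations.
   Context: An instance consists of a finite set $I$ of resources and arrivals $T=\{1,2,\dots,T\}$ arriving one at a time in this order. For each arrival $t$ there is a finite set $N_t$ of feasible configurations, each a pair $(R,t)$ with $R\subseteq I$; let $N=\bigcup_{t\in T}N_t$ and $N_i=\{(R,t)\in N: i\in R\}$. A set $S\subseteq N$ is a feasible allocation if $|S\cap N_t|\le 1$ for all $t$. Each resource $i$ has an objective function $f_i:2^N\to\mathbb{R}_{\ge 0}$ that is monotone, has $f_i(\emptyset)=0$, satisfies $f_i(S)=f_i(S\cap N_i)$ for all $S\subseteq N$, and is linear over each $N_t$: $f_i(N_t\cup S)=f_i(S)+\sum_{e\in N_t} f_i(e\mid S)$ for all $S\subseteq N\setminus N_t$, where $f(X\mid S)=f(X\cup S)-f(S)$ and $f(e\mid S)=f(\{e\}\mid S)$. Submodular order: for a total order $\pi$ on $N$, a set $C$ succeeds a set $A$ if every element of $C$ comes after every element of $A$ in $\pi$; sets $B\subseteq A$ are $\pi$-nested if $A\setminus B$ succeeds $B$; $\pi$ is a submodular order for $f$ if $f(C\mid A)\le f(C\mid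 B)$ for all $\pi$-nested $B\subseteq A\subseteq N$ and all $C\subseteq N$ that succeed $A$. A total order on $N$ is arrival-consistent if $N_{t+1}$ succeeds $N_t$ for every $t\le T-1$. In OSOW each $f_i$ is required to have every arrival-consistent total order on $N$ as a submodular order. Online, when arrival $t$ appears the algorithm learns $N_t$ and must irrevocably choose at most one configuration in $N_t$. The Greedy algorithm, with $\mathrm{ALG}(t)$ the set of configurations it chose before arrival $t$, chooses $\mathrm{ALG}_t\in\arg\max_{e\in N_t}\sum_{i\in I} f_i(e\mid \mathrm{ALG}(t))$.
   Formalization: The objective functions $f_i$ take only nonnegative rational values rather than values in ℝ≥0. -}

module Defs where

open import Data.Nat as ℕ using (ℕ; zero; suc)
open import Data.Bool using (Bool; true; false; _∧_; if_then_else_)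
open import Data.Fin as Fin using (Fin; toℕ)
open import Data.Fin.Subset using (Subset; ⊥; ⁅_⁆; _∪_; _∩_; _─_; _⊆_; _∈_)
open import Data.Fin.Subset.Properties using (_∈?_)
open import Data.Vec using (tabulate)
open import Data.Maybe using (Maybe; just; nothing)
open import Data.Rational using (ℚ; 0ℚ; _+_; _-_; _≤_; _<_)
open import Data.Product using (_×_)
open import Relation.Nullary using (¬_; does)
open import Relation.Binary.PropositionalEquality using (_≡_; _≢_)
open import Function.Definitions using (Injective)

ΣFin : (k : ℕ) → (Fin k → ℚ) → ℚ
ΣFin zero    g = 0ℚ
ΣFin (suc k) g = g Fin.zero + ΣFin k (λ j → g (Fin.suc j))

-- An instance: resources I = Fin m, arrivals T = Fin n (arrival t ↔ t+1),
-- configurations N = Fin M; configuration e is the pair (res e , arr e).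

ConfigsArePairs : {m n M : ℕ} → (Fin M → Fin n) → (Fin M → Subset m) → Set
ConfigsArePairs arr res = ∀ e e' → arr e ≡ arr e' → res e ≡ res e' → e ≡ e'

Nt : {n M : ℕ} → (Fin M → Fin n) → Fin n → Subset M
Nt arr t = tabulate (λ e → does (arr e Fin.≟ t))

Ni : {m M : ℕ} → (Fin M → Subset m) → Fin m → Subset M
Ni res i = tabulate (λ e → does (i ∈? res e))

marg : {M : ℕ} → (Subset M → ℚ) → Subset M → Subset M → ℚ
marg f X S = f (X ∪ S) - f S

margₑ : {M : ℕ} → (Subset M → ℚ) → Fin M → Subset M → ℚ
margₑ f e S = marg f ⁅ e ⁆ S

Monotone : {M : ℕ} → (Subset M → ℚ) → Set
Monotone f = ∀ A B → A ⊆ B → f A ≤ f B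

NonNegative : {M : ℕ} → (Subset M → ℚ) → Set
NonNegative f = ∀ S → 0ℚ ≤ f S

DependsOnlyOn : {M : ℕ} → (Subset M → ℚ) → Subset M → Set
DependsOnlyOn f Q = ∀ S → f S ≡ f (S ∩ Q)

LinearOver : {n M : ℕ} → (Fin M → Fin n) → (Subset M → ℚ) → Fin n → Set
LinearOver {n} {M} arr f t =
  ∀ S → S ∩ Nt arr t ≡ ⊥ →
  f (Nt arr t ∪ S) ≡ f S + ΣFin M (λ e → if does (arr e Fin.≟ t) then margₑ f e S else 0ℚ)

-- Total orders on N, represented by an injective position map
-- pos : Fin M → ℕ (e before e' in π iff pos e < pos e').

Succeeds : {M : ℕ} → (Fin M → ℕ) → Subset M → Subset M → Set
Succeeds pos C A = ∀ c a → c ∈ C → a ∈ A → pos a ℕ.< pos c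

Nested : {M : ℕ} → (Fin M → ℕ) → Subset M → Subset M → Set
Nested pos B A = B ⊆ A × Succeeds pos (A ─ B) B

SubmodularOrder : {M : ℕ} → (Fin M → ℕ) → (Subset M → ℚ) → Set
SubmodularOrder pos f =
  ∀ B A C → Nested pos B A → Succeeds pos C A → marg f C A ≤ marg f C B

ArrivalConsistent : {n M : ℕ} → (Fin M → Fin n) → (Fin M → ℕ) → Set
ArrivalConsistent arr pos =
  ∀ e e' → toℕ (arr e') ≡ suc (toℕ (arr e)) → pos e ℕ.< pos e'

OSOWOrder : {n M : ℕ} → (Fin M → Fin n) → (Subset M → ℚ) → Set
OSOWOrder arr f =
  ∀ pos → Injective _≡_ _≡_ pos → ArrivalConsistent arr pos → SubmodularOrder pos f

IsOSOW : {m n M : ℕ} → (Fin M → Fin n) → (Fin M → Subset m) →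
         (Fin m → Subset M → ℚ) → Set
IsOSOW {m} {n} {M} arr res f =
  ConfigsArePairs arr res ×
  (∀ i → Monotone (f i)) ×
  (∀ i → NonNegative (f i)) ×
  (∀ i → f i ⊥ ≡ 0ℚ) ×
  (∀ i → DependsOnlyOn (f i) (Ni res i)) ×
  (∀ i t → LinearOver arr (f i) t) ×
  (∀ i → OSOWOrder arr (f i))

Welfare : {m M : ℕ} → (Fin m → Subset M → ℚ) → Subset M → ℚ
Welfare {m} f S = ΣFin m (λ i → f i S)

WelfareGain : {m M : ℕ} → (Fin m → Subset M → ℚ) → Fin M → Subset M → ℚ
WelfareGain {m} f e S = ΣFin m (λ i → margₑ (f i) e S)

Feasible : {n M : ℕ} → (Fin M → Fin n) → Subset M → Set
Feasible arr S = ∀ e e' → e ∈ S → e' ∈ S → arr e ≡ arr e' → e ≡ e'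

-- A run of the algorithm: choice t = the configuration chosen at arrival t
-- (nothing = no configuration chosen).
isChosen : {n M : ℕ} → (Fin M → Fin n) → (Fin n → Maybe (Fin M)) → Fin M → Bool
isChosen arr choice e with choice (arr e)
... | nothing = false
... | just e' = does (e Fin.≟ e')

ALGset : {n M : ℕ} → (Fin M → Fin n) → (Fin n → Maybe (Fin M)) → Subset M
ALGset arr choice = tabulate (isChosen arr choice)

ALGbefore : {n M : ℕ} → (Fin M → Fin n) → (Fin n → Maybe (Fin M)) → Fin n → Subset M
ALGbefore arr choice t =
  tabulate (λ e → (toℕ (arr e) ℕ.<ᵇ toℕ t) ∧ isChosen arr choice e)

IsGreedyRun : {m n M : ℕ} → (Fin M → Fin n) → (Fin m → Subset M → ℚ) →
              (Fin n → Maybe (Fin M)) → Set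
IsGreedyRun arr f choice = ∀ t → GreedyStep t (choice t)
  where
  GreedyStep : _ → Maybe _ → Set
  GreedyStep t nothing  = ∀ e → arr e ≢ t
  GreedyStep t (just e) =
    arr e ≡ t ×
    (∀ e' → arr e' ≡ t →
       WelfareGain f e' (ALGbefore arr choice t) ≤ WelfareGain f e (ALGbefore arr choice t))

{-# OPTIONS --safe #-}
-- Order the configurations arrival by arrival and let A_k be Greedy's picks
-- before arrival k and O_k the part of S arriving at k or later.  The
-- potential W(O_k ∪ A_k) + W(A_k) never decreases: the submodular-order
-- inequality for the nested pair A_k ⊆ (S ∩ N_k) ∪ A_k trades S's (unique)
-- configuration at arrival k against A_k, and Greedy's pick at k is worth at
-- least as much as that configuration.  At k = 0 the potential is at least
-- W(S); once all arrivals are processed it is at most 2 W(ALG).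
module Submission where

open import Defs
open import Data.Nat using (ℕ)
open import Data.Fin using (Fin)
open import Data.Fin.Subset using (Subset)
open import Data.Maybe using (Maybe)
open import Data.Rational using (ℚ; ½; _*_; _≤_)

open import Data.Nat as ℕ using (zero; suc)
import Data.Nat.Properties as ℕ
open import Data.Fin as Fin using (toℕ)
import Data.Fin.Properties as Fin
open import Data.Fin.Subset using (inside; outside; _∈_; _∉_; _⊆_; _∪_; _─_; ⁅_⁆)
open import Data.Fin.Subset.Properties using (x∈p∪q⁻; p⊆p∪q; q⊆p∪q; x∈⁅x⁆; x∈⁅y⁆⇒x≡y; p─q⊆p; nonempty?)
open import Data.Vec using (_∷_; here; there; tabulate; lookup)
open import Data.Vec.Properties using (lookup∘tabulate; []=⇒lookup; lookup⇒[]=)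
open import Data.Bool using (Bool; T; _∧_)
open import Data.Bool.Properties using (T-≡; T-∧)
open import Data.Maybe using (just; nothing)
open import Data.Rational using (0ℚ; _+_; _-_)
import Data.Rational.Properties as ℚ
open import Data.Rational.Solver using (module +-*-Solver)
open import Data.Product using (_×_; _,_; proj₁; proj₂)
open import Data.Sum using ([_,_]; [_,_]′; inj₁; inj₂)
open import Data.Empty using (⊥-elim)
open import Function using (_∘_)
open import Function.Bundles using (Equivalence)
open import Function.Definitions using (Injective)
open import Relation.Nullary using (yes; no)
open import Relation.Nullary.Decidable using (dec-true)
open import Relation.Binary.PropositionalEquality
  using (_≡_; refl; sym; trans; cong; subst; subst₂; module ≡-Reasoning)

open Equivalence using (to; from)

private
  variable
    k : ℕ
    x : Fin k
    p q r : Subset k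

∈⇒T-lookup : x ∈ p → T (lookup p x)
∈⇒T-lookup = from T-≡ ∘ []=⇒lookup

T-lookup⇒∈ : T (lookup p x) → x ∈ p
T-lookup⇒∈ = lookup⇒[]= _ _ ∘ to T-≡

∈-tabulate⁻ : (g : Fin k → Bool) {x : Fin k} → x ∈ tabulate g → T (g x)
∈-tabulate⁻ g {x} = subst T (lookup∘tabulate g x) ∘ ∈⇒T-lookup

∈-tabulate⁺ : (g : Fin k → Bool) {x : Fin k} → T (g x) → x ∈ tabulate g
∈-tabulate⁺ g {x} = T-lookup⇒∈ ∘ subst T (sym (lookup∘tabulate g x))

x∈p─q⇒x∉q : ∀ (p q : Subset k) → x ∈ p ─ q → x ∉ q
x∈p─q⇒x∉q {x = Fin.zero}  (_ ∷ p) (inside  ∷ q) ()         _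
x∈p─q⇒x∉q {x = Fin.zero}  (_ ∷ p) (outside ∷ q) _          ()
x∈p─q⇒x∉q {x = Fin.suc x} (_ ∷ p) (_ ∷ q) (there x∈) (there x∈q) = x∈p─q⇒x∉q p q x∈ x∈q

x∈p∪q─q⇒x∈p : ∀ (p q : Subset k) → x ∈ p ∪ q ─ q → x ∈ p
x∈p∪q─q⇒x∈p p q x∈ = [ (λ x∈p → x∈p) , ⊥-elim ∘ x∈p─q⇒x∉q (p ∪ q) q x∈ ]
  (x∈p∪q⁻ p q (p─q⊆p (p ∪ q) q x∈))

∪-least : p ⊆ r → q ⊆ r → p ∪ q ⊆ r
∪-least {p = p} {q = q} p⊆r q⊆r = [ p⊆r , q⊆r ] ∘ x∈p∪q⁻ p q

module _ where
  open +-*-Solver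

  p-q+[r-s]≡p+r-[q+s] : ∀ p q r s → (p - q) + (r - s) ≡ (p + r) - (q + s)
  p-q+[r-s]≡p+r-[q+s] = solve 4 (λ p q r s → (p :- q) :+ (r :- s) := (p :+ r) :- (q :+ s)) refl

  p-q+[q+r]≡p+r : ∀ p q r → (p - q) + (q + r) ≡ p + r
  p-q+[q+r]≡p+r = solve 3 (λ p q r → (p :- q) :+ (q :+ r) := p :+ r) refl

  p-q+q≡p : ∀ p q → (p - q) + q ≡ p
  p-q+q≡p = solve 2 (λ p q → (p :- q) :+ q := p) refl

p-q≤r-s⇒p+s≤r+q : ∀ p q r s → p - q ≤ r - s → p + s ≤ r + q
p-q≤r-s⇒p+s≤r+q p q r s le = subst₂ _≤_ (p-q+[q+r]≡p+r p q s)
  (trans (cong (r - s +_) (ℚ.+-comm q s)) (p-q+[q+r]≡p+r r s q))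
  (ℚ.+-monoˡ-≤ (q + s) le)

p-r≤q-r⇒p≤q : ∀ p q r → p - r ≤ q - r → p ≤ q
p-r≤q-r⇒p≤q p q r le = subst₂ _≤_ (p-q+q≡p p r) (p-q+q≡p q r) (ℚ.+-monoˡ-≤ r le)

p≤q+q⇒½*p≤q : ∀ p q → p ≤ q + q → ½ * p ≤ q
p≤q+q⇒½*p≤q p q le = ℚ.≤-trans (ℚ.*-monoˡ-≤-nonNeg ½ le) (ℚ.≤-reflexive (begin
  ½ * (q + q)      ≡⟨ ℚ.*-distribˡ-+ ½ q q ⟩
  ½ * q + ½ * q    ≡⟨ ℚ.*-distribʳ-+ q ½ ½ ⟨
  (½ + ½) * q      ≡⟨ ℚ.*-identityˡ q ⟩
  q                ∎))
  where open ≡-Reasoning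

ΣFin-mono-≤ : ∀ k (g h : Fin k → ℚ) → (∀ i → g i ≤ h i) → ΣFin k g ≤ ΣFin k h
ΣFin-mono-≤ zero    g h g≤h = ℚ.≤-refl
ΣFin-mono-≤ (suc k) g h g≤h =
  ℚ.+-mono-≤ (g≤h Fin.zero) (ΣFin-mono-≤ k (g ∘ Fin.suc) (h ∘ Fin.suc) (g≤h ∘ Fin.suc))

ΣFin-nonNeg : ∀ k (g : Fin k → ℚ) → (∀ i → 0ℚ ≤ g i) → 0ℚ ≤ ΣFin k g
ΣFin-nonNeg zero    g 0≤g = ℚ.≤-refl
ΣFin-nonNeg (suc k) g 0≤g = ℚ.+-mono-≤ (0≤g Fin.zero) (ΣFin-nonNeg k (g ∘ Fin.suc) (0≤g ∘ Fin.suc))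

ΣFin-distrib-minus : ∀ k (g h : Fin k → ℚ) → ΣFin k (λ i → g i - h i) ≡ ΣFin k g - ΣFin k h
ΣFin-distrib-minus zero    g h = refl
ΣFin-distrib-minus (suc k) g h = trans
  (cong (g Fin.zero - h Fin.zero +_) (ΣFin-distrib-minus k (g ∘ Fin.suc) (h ∘ Fin.suc)))
  (p-q+[r-s]≡p+r-[q+s] (g Fin.zero) (h Fin.zero) _ _)

module _ {m M : ℕ} (f : Fin m → Subset M → ℚ) where

  Monotone-Welfare : (∀ i → Monotone (f i)) → Monotone (Welfare f)
  Monotone-Welfare mono X Y X⊆Y = ΣFin-mono-≤ m _ _ (λ i → mono i X Y X⊆Y)

  NonNegative-Welfare : (∀ i → NonNegative (f i)) → NonNegative (Welfare f)
  NonNegative-Welfare nonNeg X = ΣFin-nonNeg m _ (λ i → nonNeg i X)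

  marg-Welfare : ∀ C X → ΣFin m (λ i → marg (f i) C X) ≡ marg (Welfare f) C X
  marg-Welfare C X = ΣFin-distrib-minus m (λ i → f i (C ∪ X)) (λ i → f i X)

  SubmodularOrder-Welfare : ∀ pos → (∀ i → SubmodularOrder pos (f i)) →
                            SubmodularOrder pos (Welfare f)
  SubmodularOrder-Welfare pos sub B A C nested C≻A =
    subst₂ _≤_ (marg-Welfare C A) (marg-Welfare C B) (ΣFin-mono-≤ m _ _ (λ i → sub i B A C nested C≻A))

  WelfareGain≤⇒Welfare∪≤ : ∀ e e' X → WelfareGain f e X ≤ WelfareGain f e' X →
                           Welfare f (⁅ e ⁆ ∪ X) ≤ Welfare f (⁅ e' ⁆ ∪ X)
  WelfareGain≤⇒Welfare∪≤ e e' X le = p-r≤q-r⇒p≤q _ _ _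
    (subst₂ _≤_ (marg-Welfare ⁅ e ⁆ X) (marg-Welfare ⁅ e' ⁆ X) le)

module _ {M : ℕ} (pos : Fin M → ℕ) where

  Succeeds⇒Nested : ∀ {D B} → Succeeds pos D B → Nested pos B (D ∪ B)
  Succeeds⇒Nested {D} {B} D≻B = q⊆p∪q D B , λ c b c∈ → D≻B c b (x∈p∪q─q⇒x∈p D B c∈)

  SubmodularOrder-exchange : ∀ (W : Subset M → ℚ) → SubmodularOrder pos W →
    ∀ {B C D} → Succeeds pos D B → Succeeds pos C (D ∪ B) →
    W (C ∪ (D ∪ B)) + W B ≤ W (C ∪ B) + W (D ∪ B)
  SubmodularOrder-exchange W sub {B} {C} {D} D≻B C≻D∪B =
    p-q≤r-s⇒p+s≤r+q (W (C ∪ (D ∪ B))) (W (D ∪ B)) (W (C ∪ B)) (W B)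
      (sub B (D ∪ B) C (Succeeds⇒Nested D≻B) C≻D∪B)

ascending⇒≤ : (g : ℕ → ℚ) → (∀ k → g k ≤ g (suc k)) → ∀ n → g 0 ≤ g n
ascending⇒≤ g up zero    = ℚ.≤-refl
ascending⇒≤ g up (suc n) = ℚ.≤-trans (ascending⇒≤ g up n) (up n)

module _ {n M : ℕ} (arr : Fin M → Fin n) where

  arrivalMajor : Fin M → ℕ
  arrivalMajor e = toℕ (Fin.combine (arr e) e)

  arrivalMajor-< : ∀ a c → toℕ (arr a) ℕ.< toℕ (arr c) → arrivalMajor a ℕ.< arrivalMajor c
  arrivalMajor-< a c = Fin.combine-monoˡ-< a c

  arrivalMajor-injective : Injective _≡_ _≡_ arrivalMajor
  arrivalMajor-injective {a} {c} eq =
    Fin.combine-injectiveʳ (arr a) a (arr c) c (Fin.toℕ-injective eq)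

  arrivalMajor-consistent : ArrivalConsistent arr arrivalMajor
  arrivalMajor-consistent a c eq = arrivalMajor-< a c (ℕ.≤-reflexive (sym eq))

module Greedy {m n M : ℕ} (arr : Fin M → Fin n) (f : Fin m → Subset M → ℚ)
  (mono : ∀ i → Monotone (f i)) (nonNeg : ∀ i → NonNegative (f i))
  (order : ∀ i → OSOWOrder arr (f i))
  (choice : Fin n → Maybe (Fin M)) (run : IsGreedyRun arr f choice)
  (S : Subset M) (feasible : Feasible arr S) where

  W : Subset M → ℚ
  W = Welfare f

  W-mono : ∀ {X Y} → X ⊆ Y → W X ≤ W Y
  W-mono = Monotone-Welfare f mono _ _

  pos : Fin M → ℕ
  pos = arrivalMajor arr

  W-submodular : SubmodularOrder pos W
  W-submodular = SubmodularOrder-Welfare f pos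
    (λ i → order i pos (arrivalMajor-injective arr) (arrivalMajor-consistent arr))

  arrival : Fin M → ℕ
  arrival e = toℕ (arr e)

  ALG : Subset M
  ALG = ALGset arr choice

  -- Definitionally equal to ALGbefore arr choice t when k = toℕ t.
  ALG< : ℕ → Subset M
  ALG< k = tabulate (λ e → (arrival e ℕ.<ᵇ k) ∧ isChosen arr choice e)

  S≥ : ℕ → Subset M
  S≥ k = tabulate (λ e → (k ℕ.≤ᵇ arrival e) ∧ lookup S e)

  S= : ℕ → Subset M
  S= k = tabulate (λ e → (arrival e ℕ.≡ᵇ k) ∧ lookup S e)

  ∈ALG<⁻ : ∀ {k x} → x ∈ ALG< k → arrival x ℕ.< k × x ∈ ALG
  ∈ALG<⁻ x∈ with to T-∧ (∈-tabulate⁻ _ x∈)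
  ... | before , chosen = ℕ.<ᵇ⇒< _ _ before , ∈-tabulate⁺ _ chosen

  ∈ALG<⁺ : ∀ {k x} → arrival x ℕ.< k → T (isChosen arr choice x) → x ∈ ALG< k
  ∈ALG<⁺ before chosen = ∈-tabulate⁺ _ (from T-∧ (ℕ.<⇒<ᵇ before , chosen))

  ∈S≥⁻ : ∀ {k x} → x ∈ S≥ k → k ℕ.≤ arrival x × x ∈ S
  ∈S≥⁻ x∈ with to T-∧ (∈-tabulate⁻ _ x∈)
  ... | from-k , x∈S = ℕ.≤ᵇ⇒≤ _ _ from-k , T-lookup⇒∈ x∈S

  ∈S≥⁺ : ∀ {k x} → k ℕ.≤ arrival x → x ∈ S → x ∈ S≥ k
  ∈S≥⁺ from-k x∈S = ∈-tabulate⁺ _ (from T-∧ (ℕ.≤⇒≤ᵇ from-k , ∈⇒T-lookup x∈S))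

  ∈S=⁻ : ∀ {k x} → x ∈ S= k → arrival x ≡ k × x ∈ S
  ∈S=⁻ x∈ with to T-∧ (∈-tabulate⁻ _ x∈)
  ... | at-k , x∈S = ℕ.≡ᵇ⇒≡ _ _ at-k , T-lookup⇒∈ x∈S

  ∈S=⁺ : ∀ {k x} → arrival x ≡ k → x ∈ S → x ∈ S= k
  ∈S=⁺ at-k x∈S = ∈-tabulate⁺ _ (from T-∧ (ℕ.≡⇒≡ᵇ _ _ at-k , ∈⇒T-lookup x∈S))

  ALG<-step : ∀ k → ALG< k ⊆ ALG< (suc k)
  ALG<-step k x∈ with ∈ALG<⁻ x∈
  ... | before , x∈ALG = ∈ALG<⁺ (ℕ.m<n⇒m<1+n before) (∈-tabulate⁻ _ x∈ALG)

  S≥-split : ∀ k → S≥ k ⊆ S≥ (suc k) ∪ S= k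
  S≥-split k x∈ with ∈S≥⁻ x∈
  ... | from-k , x∈S with ℕ.m≤n⇒m<n∨m≡n from-k
  ... | inj₁ after-k = p⊆p∪q (S= k) (∈S≥⁺ after-k x∈S)
  ... | inj₂ at-k    = q⊆p∪q (S≥ (suc k)) (S= k) (∈S=⁺ (sym at-k) x∈S)

  S=-unique : ∀ {k x y} → x ∈ S= k → y ∈ S= k → x ≡ y
  S=-unique x∈ y∈ with ∈S=⁻ x∈ | ∈S=⁻ y∈
  ... | x-at-k , x∈S | y-at-k , y∈S =
    feasible _ _ x∈S y∈S (Fin.toℕ-injective (trans x-at-k (sym y-at-k)))

  separated⇒Succeeds : ∀ {C A} k → (∀ {a} → a ∈ A → arrival a ℕ.< k) →
                       (∀ {c} → c ∈ C → k ℕ.≤ arrival c) → Succeeds pos C A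
  separated⇒Succeeds k A<k k≤C c a c∈ a∈ =
    arrivalMajor-< arr a c (ℕ.<-≤-trans (A<k a∈) (k≤C c∈))

  chosen-self : ∀ a → choice (arr a) ≡ just a → T (isChosen arr choice a)
  chosen-self a chose-a rewrite chose-a = from T-≡ (dec-true (a Fin.≟ a) refl)

  greedy-choice : ∀ o → W (⁅ o ⁆ ∪ ALG< (arrival o)) ≤ W (ALG< (suc (arrival o)))
  greedy-choice o with choice (arr o) in chose-a | run (arr o)
  ... | nothing | no-config   = ⊥-elim (no-config o refl)
  ... | just a  | arr-a , best = ℚ.≤-trans
    (WelfareGain≤⇒Welfare∪≤ f o a (ALG< (arrival o)) (best o refl))
    (W-mono (∪-least a-picked (ALG<-step (arrival o))))
    where
    a-picked : ⁅ a ⁆ ⊆ ALG< (suc (arrival o))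
    a-picked x∈ with refl ← x∈⁅y⁆⇒x≡y a x∈ =
      ∈ALG<⁺ (ℕ.≤-reflexive (cong (suc ∘ toℕ) arr-a))
             (chosen-self a (trans (cong choice arr-a) chose-a))

  greedy-step : ∀ k → W (S= k ∪ ALG< k) ≤ W (ALG< (suc k))
  greedy-step k with nonempty? (S= k)
  ... | no ∄o = W-mono (∪-least (λ x∈ → ⊥-elim (∄o (_ , x∈))) (ALG<-step k))
  ... | yes (o , o∈) with refl ← proj₁ (∈S=⁻ o∈) =
    ℚ.≤-trans (W-mono (∪-least S=⊆⁅o⁆ (q⊆p∪q ⁅ o ⁆ _))) (greedy-choice o)
    where
    S=⊆⁅o⁆ : S= (arrival o) ⊆ ⁅ o ⁆ ∪ ALG< (arrival o)
    S=⊆⁅o⁆ x∈ with refl ← S=-unique x∈ o∈ = p⊆p∪q _ (x∈⁅x⁆ o)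

  potential : ℕ → ℚ
  potential k = W (S≥ k ∪ ALG< k) + W (ALG< k)

  potential-step : ∀ k → potential k ≤ potential (suc k)
  potential-step k = begin
    W (S≥ k ∪ A) + W A                 ≤⟨ ℚ.+-monoˡ-≤ (W A) (W-mono S≥k∪A⊆) ⟩
    W (S≥ (suc k) ∪ (S= k ∪ A)) + W A  ≤⟨ SubmodularOrder-exchange pos W W-submodular S=≻A S≥≻S=∪A ⟩
    W (S≥ (suc k) ∪ A) + W (S= k ∪ A)  ≤⟨ ℚ.+-mono-≤ (W-mono S≥∪A⊆) (greedy-step k) ⟩
    W (S≥ (suc k) ∪ A′) + W A′         ∎
    where
    open ℚ.≤-Reasoning
    A A′ : Subset M
    A  = ALG< k
    A′ = ALG< (suc k)
    S≥k∪A⊆ : S≥ k ∪ A ⊆ S≥ (suc k) ∪ (S= k ∪ A)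
    S≥k∪A⊆ = ∪-least
      (∪-least (p⊆p∪q _) (q⊆p∪q _ _ ∘ p⊆p∪q A) ∘ S≥-split k)
      (q⊆p∪q _ _ ∘ q⊆p∪q (S= k) A)
    S≥∪A⊆ : S≥ (suc k) ∪ A ⊆ S≥ (suc k) ∪ A′
    S≥∪A⊆ = ∪-least (p⊆p∪q A′) (q⊆p∪q _ A′ ∘ ALG<-step k)
    S=≻A : Succeeds pos (S= k) A
    S=≻A = separated⇒Succeeds k
      (proj₁ ∘ ∈ALG<⁻ {k})
      (ℕ.≤-reflexive ∘ sym ∘ proj₁ ∘ ∈S=⁻)
    S≥≻S=∪A : Succeeds pos (S≥ (suc k)) (S= k ∪ A)
    S≥≻S=∪A = separated⇒Succeeds (suc k)
      ([ ℕ.s≤s ∘ ℕ.≤-reflexive ∘ proj₁ ∘ ∈S=⁻ , ℕ.m<n⇒m<1+n ∘ proj₁ ∘ ∈ALG<⁻ {k} ]′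
         ∘ x∈p∪q⁻ (S= k) A)
      (proj₁ ∘ ∈S≥⁻)

  S≤potential₀ : W S ≤ potential 0
  S≤potential₀ = begin
    W S                               ≡⟨ ℚ.+-identityʳ (W S) ⟨
    W S + 0ℚ                          ≤⟨ ℚ.+-mono-≤ (W-mono (p⊆p∪q _ ∘ ∈S≥⁺ ℕ.z≤n))
                                                    (NonNegative-Welfare f nonNeg (ALG< 0)) ⟩
    W (S≥ 0 ∪ ALG< 0) + W (ALG< 0)    ∎
    where open ℚ.≤-Reasoning

  potential≤2ALG : potential n ≤ W ALG + W ALG
  potential≤2ALG = ℚ.+-mono-≤ (W-mono (∪-least S≥n⊆ALG ALG<n⊆ALG)) (W-mono ALG<n⊆ALG)
    where
    ALG<n⊆ALG : ALG< n ⊆ ALG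
    ALG<n⊆ALG = proj₂ ∘ ∈ALG<⁻ {n}
    S≥n⊆ALG : S≥ n ⊆ ALG
    S≥n⊆ALG {x} x∈ =
      ⊥-elim (ℕ.<-irrefl refl (ℕ.<-≤-trans (Fin.toℕ<n (arr x)) (proj₁ (∈S≥⁻ x∈))))

  S≤2ALG : W S ≤ W ALG + W ALG
  S≤2ALG = begin
    W S            ≤⟨ S≤potential₀ ⟩
    potential 0    ≤⟨ ascending⇒≤ potential potential-step n ⟩
    potential n    ≤⟨ potential≤2ALG ⟩
    W ALG + W ALG  ∎
    where open ℚ.≤-Reasoning

theorem1 : (m n M : ℕ) (arr : Fin M → Fin n) (res : Fin M → Subset m)
           (f : Fin m → Subset M → ℚ) →
           IsOSOW arr res f →
           (choice : Fin n → Maybe (Fin M)) → IsGreedyRun arr f choice →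
           (S : Subset M) → Feasible arr S →
           ½ * Welfare f S ≤ Welfare f (ALGset arr choice)
theorem1 m n M arr res f (_ , mono , nonNeg , _ , _ , _ , order) choice run S feasible =
  p≤q+q⇒½*p≤q _ _ (Greedy.S≤2ALG arr f mono nonNeg order choice run S feasible)
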